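{- Work in Bishop-style constructive mathematics. For each fan $T$, the principle "every monotone $\Pi^0_1$ bar of the universal spread $\mathbb{N}^*$ is uniform with respect to $T$" is equivalent to the principle "every c-bar of $\mathbb{N}^*$ is uniform with respect to $T$".
   Context: $\mathbb{N}^*$ is the set of finite sequences of natural numbers, $a*b$ concatenation, $\overline{\alpha}n$ the initial segment of length $n$ of $\alpha$. A tree is an inhabited decidable subset of $\mathbb{N}^*$ closed under initial segments. A spread is a tree $T$ with $\forall a\in T\,\exists n\,(a*\langle n\rangle\in T)$; a path of $T$ is $\alpha$ with $\forall n\,(\overline{\alpha}n\in T)$. A fan is a spread $T$ with $\forall a\in T\,\exists N\,\forall n\,[a*\langle n\rangle\in T\to n\le N]$. For a spread $S$, $P\subseteq S$ is a bar of $S$ if every path $\alpha$ of $S$ has some $n$ with $\overline{\alpha}n\in P$; a uniform bar if there is $N$ such that every path of $S$ has some $n\le N$ with $\overline{\alpha}n\in P$; $\Pi^0_1$ if $P=\bigcap_n B_n$ with each $B_n\subseteq S$ decidable; monotone if $a\in P$, $a*b\in S$ imply $a*b\in P$. A subset $P\subseteq S$ is a c-set if there is a decidable $D\subseteq\mathbb{N}^*$ with $P(a)\leftrightarrow\forall b\in\mathbb{N}^*\,(a*b\in D)$ for all $a\in S$; a c-bar is a c-set that is a bar. The universal spread is $\mathbb{N}^*$. For a fan $T$, a bar $P$ of $\mathbb{N}^*$ is uniform with respect to $T$ if $P\cap T$ is a uniform bar of $T$. -}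

module Defs where

open import Data.Nat using (ℕ; _≤_)
open import Data.Bool using (Bool; true)
open import Data.List using (List; _++_; [_]; applyUpTo)
open import Data.Product using (Σ; ∃; _×_)
open import Relation.Binary.PropositionalEquality using (_≡_)
open import Function.Bundles using (_⇔_)

-- ℕ* : finite sequences of naturals; a * b is list concatenation _++_.
Seq : Set
Seq = List ℕ

DecSubset : Set
DecSubset = Seq → Bool

initSeg : (ℕ → ℕ) → ℕ → Seq
initSeg α n = applyUpTo α n

IsTree : DecSubset → Set
IsTree T = (∃ λ a → T a ≡ true) × (∀ a b → T (a ++ b) ≡ true → T a ≡ true)

IsSpread : DecSubset → Set
IsSpread T = IsTree T × (∀ a → T a ≡ true → ∃ λ n → T (a ++ [ n ]) ≡ true)

IsFan : DecSubset → Set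
IsFan T = IsSpread T × (∀ a → T a ≡ true → ∃ λ N → ∀ n → T (a ++ [ n ]) ≡ true → n ≤ N)

IsPath : DecSubset → (ℕ → ℕ) → Set
IsPath T α = ∀ n → T (initSeg α n) ≡ true

universal : DecSubset
universal _ = true

Subset : Set₁
Subset = Seq → Set

_⊆_ : Subset → DecSubset → Set
P ⊆ S = ∀ a → P a → S a ≡ true

IsBar : DecSubset → Subset → Set
IsBar S P = P ⊆ S × (∀ α → IsPath S α → ∃ λ n → P (initSeg α n))

IsUniformBar : DecSubset → Subset → Set
IsUniformBar S P = P ⊆ S × (∃ λ N → ∀ α → IsPath S α → ∃ λ n → n ≤ N × P (initSeg α n))

IsΠ⁰₁ : DecSubset → Subset → Set
IsΠ⁰₁ S P = P ⊆ S × (Σ (ℕ → DecSubset) λ B →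
  (∀ n a → B n a ≡ true → S a ≡ true) × (∀ a → P a ⇔ (∀ n → B n a ≡ true)))

IsMonotone : DecSubset → Subset → Set
IsMonotone S P = ∀ a b → P a → S (a ++ b) ≡ true → P (a ++ b)

IsCSet : DecSubset → Subset → Set
IsCSet S P = P ⊆ S × (Σ DecSubset λ D → ∀ a → S a ≡ true → (P a ⇔ (∀ b → D (a ++ b) ≡ true)))

IsCBar : DecSubset → Subset → Set
IsCBar S P = IsCSet S P × IsBar S P

_∩_ : Subset → DecSubset → Subset
(P ∩ T) a = P a × T a ≡ true

UniformWrt : DecSubset → Subset → Set
UniformWrt T P = IsUniformBar T (P ∩ T)

MonΠ⁰₁-UB : DecSubset → Set₁
MonΠ⁰₁-UB T = ∀ (P : Subset) → IsMonotone universal P → IsΠ⁰₁ universal P →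
  IsBar universal P → UniformWrt T P

C-UB : DecSubset → Set₁
C-UB T = ∀ (P : Subset) → IsCBar universal P → UniformWrt T P

-- (⇒) A c-set P, given by P a ⇔ ∀ b. D (a * b), is monotone, and it is Π⁰₁:
--     enumerate ℕ* as enum 0, enum 1, … (Cantor's zig-zag) and put
--     Bₙ a = D (a * enum n).  So every c-bar is a monotone Π⁰₁ bar.
-- (⇐) Given a monotone bar P = ⋂ₙ Bₙ, build a decidable D that only looks
--     at the last step s ↦ s * ⟨m⟩ of a sequence: D rejects it exactly when
--     s lies in T, s * ⟨m⟩ leaves T, and one of B₀ s, …, Bₘ s fails.  For the
--     c-set Q a = ∀ b. D (a * b) we show
--       · on T, Q agrees with P: monotonicity gives P ⊆ Q, and the fan bound
--         at a lets arbitrarily large m leave T, which gives Q ⊆ P;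
--       · Q is a bar: a path hits P at some node, which is either in T (then
--         it is in Q) or outside T (then its one-step extension is in Q).
--     Uniformity of the c-bar Q w.r.t. T then transfers to P.
module Submission where

open import Defs
open import Function.Base using (id)
open import Function.Bundles using (_⇔_; mk⇔; Equivalence)
open import Data.Nat using (ℕ; zero; suc; _+_; _≤_; z≤n; s≤s)
open import Data.Nat.Properties using (+-suc; +-identityʳ; m≤n⇒m<n∨m≡n; m≤m+n; m≤n+m; <⇒≱)
open import Data.Bool using (Bool; true; false; _∧_; _∨_; not)
open import Data.Bool.Properties using (∧-conicalˡ; ∧-conicalʳ; ∨-zeroʳ; ¬-not)
open import Data.List using ([]; _∷_; _++_; [_]; length; reverse)
open import Data.List.Properties using (++-assoc; ++-identityʳ; reverse-++; reverse-involutive; applyUpTo-∷ʳ)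
open import Data.List.Reverse using ([]; _∶_∶ʳ_; reverseView)
open import Data.Product using (∃; _×_; _,_; proj₁; proj₂)
open import Data.Sum using (inj₁; inj₂)
open import Relation.Binary.PropositionalEquality using (_≡_; refl; sym; trans; cong; subst; module ≡-Reasoning)

open Equivalence

-- Cantor's zig-zag through ℕ × ℕ: down the diagonal x + y = d from (0 , d)
-- to (d , 0), then on to the start (0 , d + 1) of the next diagonal.
zigzag : ℕ × ℕ → ℕ × ℕ
zigzag (x , zero) = (0 , suc x)
zigzag (x , suc y) = (suc x , y)

unpair : ℕ → ℕ × ℕ
unpair zero = (0 , 0)
unpair (suc n) = zigzag (unpair n)

unpair-walk : ∀ k {n x y} → unpair n ≡ (x , k + y) → unpair (k + n) ≡ (x + k , y)
unpair-walk zero {x = x} eq = trans eq (cong (_, _) (sym (+-identityʳ x)))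
unpair-walk (suc k) {n} {x} {y} eq = begin
  unpair (suc k + n)  ≡⟨ cong unpair (sym (+-suc k n)) ⟩
  unpair (k + suc n)  ≡⟨ unpair-walk k (cong zigzag eq) ⟩
  (suc x + k , y)     ≡⟨ cong (_, y) (sym (+-suc x k)) ⟩
  (x + suc k , y)     ∎
  where open ≡-Reasoning

unpair-diagonal : ∀ d → ∃ λ n → unpair n ≡ (0 , d)
unpair-diagonal zero = 0 , refl
unpair-diagonal (suc d) with unpair-diagonal d
... | n , eq = suc (d + n) , cong zigzag (unpair-walk d (trans eq (cong (0 ,_) (sym (+-identityʳ d)))))

unpair-surjective : ∀ x y → ∃ λ n → unpair n ≡ (x , y)
unpair-surjective x y with unpair-diagonal (x + y)
... | n , eq = x + n , unpair-walk x eq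

decodeSeq : ℕ → ℕ → Seq
decodeSeq zero _ = []
decodeSeq (suc ℓ) c = proj₁ (unpair c) ∷ decodeSeq ℓ (proj₂ (unpair c))

decodeSeq-surjective : ∀ s → ∃ λ c → decodeSeq (length s) c ≡ s
decodeSeq-surjective [] = 0 , refl
decodeSeq-surjective (x ∷ s) with decodeSeq-surjective s
... | c , eq with unpair-surjective x c
...   | n , eqₙ = n , trans (cong (λ p → proj₁ p ∷ decodeSeq (length s) (proj₂ p)) eqₙ) (cong (x ∷_) eq)

enum : ℕ → Seq
enum n = decodeSeq (proj₁ (unpair n)) (proj₂ (unpair n))

enum-surjective : ∀ s → ∃ λ n → enum n ≡ s
enum-surjective s with decodeSeq-surjective s
... | c , eq with unpair-surjective (length s) c
...   | n , eqₙ = n , trans (cong (λ p → decodeSeq (proj₁ p) (proj₂ p)) eqₙ) eq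

-- Every c-set of a decidable S is monotone: a condition on all extensions
-- of a is inherited by each extension of a.
cset-monotone : ∀ S P → IsCSet S P → IsMonotone S P
cset-monotone S P (P⊆S , D , char) a b Pa Sab = from (char (a ++ b) Sab) λ c →
  subst (λ z → D z ≡ true) (sym (++-assoc a b c)) (to (char a (P⊆S a Pa)) Pa (b ++ c))

-- Every c-set of a decidable S is Π⁰₁: quantify over ℕ* through enum.
cset-Π⁰₁ : ∀ S P → IsCSet S P → IsΠ⁰₁ S P
cset-Π⁰₁ S P (P⊆S , D , char) = P⊆S , B , B⊆S , λ a → mk⇔ (P⇒B a) (B⇒P a)
  where
  B : ℕ → DecSubset
  B n a = S a ∧ D (a ++ enum n)

  B⊆S : ∀ n a → B n a ≡ true → S a ≡ true
  B⊆S n a = ∧-conicalˡ (S a) _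

  P⇒B : ∀ a → P a → ∀ n → B n a ≡ true
  P⇒B a Pa n rewrite P⊆S a Pa = to (char a (P⊆S a Pa)) Pa (enum n)

  B⇒P : ∀ a → (∀ n → B n a ≡ true) → P a
  B⇒P a allB = from (char a (B⊆S 0 a (allB 0))) λ b →
    let (n , eq) = enum-surjective b in
    subst (λ z → D (a ++ z) ≡ true) eq (∧-conicalʳ (S a) _ (allB n))

uniform-transfer : ∀ T (P Q : Subset) → (∀ a → T a ≡ true → Q a → P a) →
  UniformWrt T Q → UniformWrt T P
uniform-transfer T P Q Q⇒P (_ , N , uniform) = (λ _ → proj₂) , N , λ α path →
  let (n , n≤N , Qα , Tα) = uniform α path in n , n≤N , Q⇒P _ Tα Qα , Tα

outside-closed : ∀ {T} → IsTree T → ∀ {a} → T a ≡ false → ∀ c → T (a ++ c) ≡ false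
outside-closed {T} (_ , prefix) {a} Ta c with T (a ++ c) in Tac
... | false = refl
... | true with trans (sym (prefix a c Tac)) Ta
...   | ()

module LastStep (T : DecSubset) (B : ℕ → DecSubset) where

  allUpTo : ℕ → DecSubset
  allUpTo zero s = B zero s
  allUpTo (suc m) s = B (suc m) s ∧ allUpTo m s

  allUpTo-intro : ∀ m {s} → (∀ k → B k s ≡ true) → allUpTo m s ≡ true
  allUpTo-intro zero allB = allB zero
  allUpTo-intro (suc m) allB rewrite allB (suc m) = allUpTo-intro m allB

  allUpTo-elim : ∀ {m k s} → allUpTo m s ≡ true → k ≤ m → B k s ≡ true
  allUpTo-elim {zero} h z≤n = h
  allUpTo-elim {suc m} {k} {s} h k≤1+m with m≤n⇒m<n∨m≡n k≤1+m
  ... | inj₁ (s≤s k≤m) = allUpTo-elim (∧-conicalʳ (B (suc m) s) _ h) k≤m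
  ... | inj₂ refl = ∧-conicalˡ _ _ h

  step : Seq → ℕ → Bool
  step s m = T (s ++ [ m ]) ∨ not (T s) ∨ allUpTo m s

  lastStepʳ : Seq → Bool
  lastStepʳ [] = true
  lastStepʳ (m ∷ rs) = step (reverse rs) m

  D : DecSubset
  D c = lastStepʳ (reverse c)

  D-snoc : ∀ s m → D (s ++ [ m ]) ≡ step s m
  D-snoc s m rewrite reverse-++ s [ m ] | reverse-involutive s = refl

  Q : Subset
  Q a = ∀ b → D (a ++ b) ≡ true

  Q-intro : ∀ {a} → D a ≡ true → (∀ b m → step (a ++ b) m ≡ true) → Q a
  Q-intro {a} Da steps b with reverseView b
  ... | [] rewrite ++-identityʳ a = Da
  ... | b′ ∶ _ ∶ʳ m rewrite sym (++-assoc a b′ [ m ]) | D-snoc (a ++ b′) m = steps b′ m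

  step-stays-inside : ∀ {s m} → T (s ++ [ m ]) ≡ true → step s m ≡ true
  step-stays-inside Tsm rewrite Tsm = refl

  step-from-outside : ∀ {s m} → T s ≡ false → step s m ≡ true
  step-from-outside {s} {m} Ts rewrite Ts = ∨-zeroʳ (T (s ++ [ m ]))

  step-passing : ∀ {s m} → (∀ k → B k s ≡ true) → step s m ≡ true
  step-passing {s} {m} allB rewrite allUpTo-intro m allB | ∨-zeroʳ (not (T s)) = ∨-zeroʳ (T (s ++ [ m ]))

  step-leaving : ∀ {s m} → T s ≡ true → T (s ++ [ m ]) ≡ false → step s m ≡ true →
    ∀ {k} → k ≤ m → B k s ≡ true
  step-leaving Ts Tsm h rewrite Ts | Tsm = allUpTo-elim h

  D-inside : ∀ {a} → T a ≡ true → D a ≡ true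
  D-inside {a} Ta with reverseView a
  ... | [] = refl
  ... | s ∶ _ ∶ʳ m rewrite D-snoc s m = step-stays-inside Ta

module FromMonotoneΠ⁰₁ (T : DecSubset) (fan : IsFan T) (P : Subset) (B : ℕ → DecSubset)
    (monotone : IsMonotone universal P) (char : ∀ a → P a ⇔ (∀ n → B n a ≡ true)) where

  open LastStep T B

  tree : IsTree T
  tree = proj₁ (proj₁ fan)

  P⇒Q : ∀ {a} → T a ≡ true → P a → Q a
  P⇒Q {a} Ta Pa = Q-intro (D-inside Ta) λ b m →
    step-passing (to (char (a ++ b)) (monotone a b Pa refl))

  -- Beyond the fan bound N at a, the step a ↦ a * ⟨n + suc N⟩ leaves T,
  -- so Q a forces B₀ a, …, B_{n + suc N} a.
  Q⇒P : ∀ {a} → T a ≡ true → Q a → P a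
  Q⇒P {a} Ta Qa = from (char a) λ n → step-leaving Ta (leaves n)
    (trans (sym (D-snoc a (n + suc N))) (Qa [ n + suc N ])) (m≤m+n n (suc N))
    where
    N : ℕ
    N = proj₁ (proj₂ fan a Ta)

    leaves : ∀ n → T (a ++ [ n + suc N ]) ≡ false
    leaves n = ¬-not λ inside → <⇒≱ (m≤n+m (suc N) n) (proj₂ (proj₂ fan a Ta) (n + suc N) inside)

  Q-outside : ∀ {a} x → T a ≡ false → Q (a ++ [ x ])
  Q-outside {a} x Ta = Q-intro (trans (D-snoc a x) (step-from-outside Ta)) λ b m →
    step-from-outside (outside-closed tree (outside-closed tree Ta [ x ]) b)

  -- A path meets P at a node inside T (then in Q) or outside T (then Q
  -- holds one step later).
  Q-bar : IsBar universal P → IsBar universal Q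
  Q-bar (_ , bar) = (λ _ _ → refl) , λ α _ → meet α (bar α (λ _ → refl))
    where
    meet : ∀ α → (∃ λ n → P (initSeg α n)) → ∃ λ n → Q (initSeg α n)
    meet α (n , Pαn) with T (initSeg α n) in Tαn
    ... | true = n , P⇒Q Tαn Pαn
    ... | false = suc n , subst Q (applyUpTo-∷ʳ α n) (Q-outside (α n) Tαn)

  Q-cbar : IsBar universal P → IsCBar universal Q
  Q-cbar bar = ((λ _ _ → refl) , D , λ _ _ → mk⇔ id id) , Q-bar bar

c-bars-from-monotone-Π⁰₁ : ∀ T → MonΠ⁰₁-UB T → C-UB T
c-bars-from-monotone-Π⁰₁ T uniformMon P (cset , bar) =
  uniformMon P (cset-monotone universal P cset) (cset-Π⁰₁ universal P cset) bar

monotone-Π⁰₁-from-c-bars : ∀ T → IsFan T → C-UB T → MonΠ⁰₁-UB T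
monotone-Π⁰₁-from-c-bars T fan uniformC P monotone (_ , B , _ , char) bar =
  uniform-transfer T P Q (λ _ → Q⇒P) (uniformC Q (Q-cbar bar))
  where open FromMonotoneΠ⁰₁ T fan P B monotone char
        open LastStep T B using (Q)

proposition3p4 : (T : DecSubset) → IsFan T → (MonΠ⁰₁-UB T ⇔ C-UB T)
proposition3p4 T fan = mk⇔ (c-bars-from-monotone-Π⁰₁ T) (monotone-Π⁰₁-from-c-bars T fan)
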